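{- Every $n$-node DAG $G=(V,E,w)$ with positive edge weights has a shortest-paths preserving graph $H=(V,E,w_H)$ of aspect ratio $O(n)$.
   Context: The aspect ratio of a graph with positive edge weights $w$ is $\max_e w(e)/\min_e w(e)$. Given a (directed or undirected) graph $G=(V,E,w)$ with positive edge weights, a reweighted graph $H=(V,E,w_H)$ on the same vertex and edge set with positive weights $w_H$ is called shortest-paths preserving if for every shortest path $\pi$ in $H$, the sequence of nodes and edges along $\pi$ is also a shortest path in $G$.
   Formalization: The edge weights $w$ of the DAG are positive rationals, and the reweighted weights $w_H$ are likewise taken in the rationals. -}

module Defs where

open import Data.Nat using (ℕ)
open import Data.Fin using (Fin)
open import Data.Integer using (+_)
open import Data.Rational using (ℚ; 0ℚ; _+_; _≤_; _<_; _/_)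
open import Data.Product using (Σ; _×_)
open import Relation.Binary.PropositionalEquality using (_≡_)
open import Relation.Nullary using (¬_)

record Graph (n : ℕ) : Set where
  field
    m   : ℕ
    src : Fin m → Fin n
    tgt : Fin m → Fin n
open Graph public

Weights : {n : ℕ} → Graph n → Set
Weights G = Fin (m G) → ℚ

PositiveWeights : {n : ℕ} (G : Graph n) → Weights G → Set
PositiveWeights G w = (e : Fin (m G)) → 0ℚ < w e

data Path {n : ℕ} (G : Graph n) : Fin n → Fin n → Set where
  []  : {u : Fin n} → Path G u u
  _∷⟨_⟩_ : {u v : Fin n} (e : Fin (m G)) → src G e ≡ u → Path G (tgt G e) v → Path G u v

len : {n : ℕ} {G : Graph n} → Weights G → {u v : Fin n} → Path G u v → ℚ
len w [] = 0ℚ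
len w (e ∷⟨ _ ⟩ p) = w e + len w p

IsDAG : {n : ℕ} → Graph n → Set
IsDAG G = ¬ (Σ (Fin (m G)) λ e → Path G (tgt G e) (src G e))

IsShortest : {n : ℕ} (G : Graph n) → Weights G → {u v : Fin n} → Path G u v → Set
IsShortest G w {u} {v} π = (ρ : Path G u v) → len w π ≤ len w ρ

ShortestPathsPreserving : {n : ℕ} (G : Graph n) → Weights G → Weights G → Set
ShortestPathsPreserving {n} G w wH =
  {u v : Fin n} (π : Path G u v) → IsShortest G wH π → IsShortest G w π

-- Aspect ratio of w is at most r: for all edges e, e',  w e ≤ r * w e'  (i.e. max/min ≤ r).
AspectRatio≤ : {n : ℕ} (G : Graph n) → Weights G → ℚ → Set
AspectRatio≤ G w r = (e e' : Fin (m G)) → w e ≤ r * w e'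
  where open Data.Rational using (_*_)

ℕ→ℚ : ℕ → ℚ
ℕ→ℚ k = (+ k) / 1

-- Let rank v be the number of edges of a longest path starting at v. In a DAG the vertices of a
-- path are distinct, so rank v < n, and rank strictly drops along every edge. With W the largest
-- weight, put wH e = w e + W · (rank (src e) − rank (tgt e)). This is a potential shift: every
-- u–v path changes length by the same amount W · (rank u − rank v), so shortest paths are
-- preserved; and as the rank drop of an edge lies in [1, n − 1], every wH e lies in [W, n W].
module Submission where

open import Defs
open import Data.Nat as ℕ using (ℕ; zero; suc; z≤n; s≤s)
import Data.Nat.Properties as ℕ
import Data.Nat.Coprimality as Coprime
import Data.Integer as ℤ
import Data.Integer.Properties as ℤ
open import Data.Fin using (Fin; zero; suc; _≟_)
open import Data.Fin.Properties using (injective⇒≤)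
open import Data.List using (List; map; filter; allFin)
import Data.List.Relation.Unary.All as All
open import Data.List.Relation.Unary.All.Properties using (all-filter; map⁺)
open import Data.List.Membership.Propositional.Properties
  using (∈-map⁺; ∈-filter⁺; ∈-allFin)
import Data.List.Extrema.Nat as ℕ-Extrema
import Data.List.Extrema
open import Data.Rational hiding (_≟_)
open import Data.Rational.Properties hiding (_≟_)
open import Data.Product using (Σ; _×_; _,_)
open import Data.Empty using (⊥-elim)
open import Function.Base using (id; _∘_)
open import Function.Definitions using (Injective)
open import Algebra.Bundles using (CommutativeMonoid)
open import Relation.Binary.Bundles using (DecTotalOrder)
open import Relation.Binary.PropositionalEquality

module _ {n : ℕ} (G : Graph n) where

  edgeCount : ∀ {u v} → Path G u v → ℕ
  edgeCount []            = 0
  edgeCount (_ ∷⟨ _ ⟩ p) = suc (edgeCount p)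

  vertexAt : ∀ {u v} (p : Path G u v) → Fin (suc (edgeCount p)) → Fin n
  vertexAt {u} p            zero    = u
  vertexAt (_ ∷⟨ _ ⟩ p) (suc i) = vertexAt p i

  prefixTo : ∀ {u v} (p : Path G u v) (i : Fin (suc (edgeCount p))) → Path G u (vertexAt p i)
  prefixTo p                 zero    = []
  prefixTo (e ∷⟨ s≡u ⟩ p) (suc i) = e ∷⟨ s≡u ⟩ prefixTo p i

  vertexAt-injective : IsDAG G → ∀ {u v} (p : Path G u v) → Injective _≡_ _≡_ (vertexAt p)
  vertexAt-injective dag []              {zero}  {zero}  _    = refl
  vertexAt-injective dag (e ∷⟨ refl ⟩ p) {zero}  {zero}  _    = refl
  vertexAt-injective dag (e ∷⟨ refl ⟩ p) {zero}  {suc j} s≡pj =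
    ⊥-elim (dag (e , subst (Path G (tgt G e)) (sym s≡pj) (prefixTo p j)))
  vertexAt-injective dag (e ∷⟨ refl ⟩ p) {suc i} {zero}  pi≡s =
    ⊥-elim (dag (e , subst (Path G (tgt G e)) pi≡s (prefixTo p i)))
  vertexAt-injective dag (e ∷⟨ refl ⟩ p) {suc i} {suc j} pi≡pj =
    cong suc (vertexAt-injective dag p pi≡pj)

  edgeCount<n : IsDAG G → ∀ {u v} (p : Path G u v) → edgeCount p ℕ.< n
  edgeCount<n dag p = injective⇒≤ (vertexAt-injective dag p)

  outEdges : Fin n → List (Fin (m G))
  outEdges u = filter (λ e → src G e ≟ u) (allFin (m G))

  open ℕ-Extrema using (max; xs≤max; argmax-all)

  longest : ℕ → Fin n → ℕ
  longest zero    u = 0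
  longest (suc k) u = max 0 (map (λ e → suc (longest k (tgt G e))) (outEdges u))

  longest-edge : ∀ k e → suc (longest k (tgt G e)) ℕ.≤ longest (suc k) (src G e)
  longest-edge k e = All.lookup (xs≤max 0 _) (∈-map⁺ (λ e → suc (longest k (tgt G e)))
    (∈-filter⁺ (λ e' → src G e' ≟ src G e) (∈-allFin e) refl))

  PathWithEdges : Fin n → ℕ → Set
  PathWithEdges u j = Σ (Fin n) λ v → Σ (Path G u v) λ p → edgeCount p ≡ j

  longest-attained : ∀ k u → PathWithEdges u (longest k u)
  longest-attained zero    u = u , [] , refl
  longest-attained (suc k) u =
    argmax-all id {P = PathWithEdges u} (u , [] , refl)
      (map⁺ (All.map extend (all-filter (λ e → src G e ≟ u) (allFin (m G)))))
    where
    extend : ∀ {e} → src G e ≡ u → PathWithEdges u (suc (longest k (tgt G e)))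
    extend {e} s≡u with longest-attained k (tgt G e)
    ... | v , p , p≡longest = v , e ∷⟨ s≡u ⟩ p , cong suc p≡longest

  longest-maximal : ∀ k {u v} (p : Path G u v) →
                    edgeCount p ℕ.≤ k → edgeCount p ℕ.≤ longest k u
  longest-maximal k       []              _         = z≤n
  longest-maximal (suc k) (e ∷⟨ refl ⟩ p) (s≤s p≤k) =
    ℕ.≤-trans (s≤s (longest-maximal k p p≤k)) (longest-edge k e)

  longest<n : IsDAG G → ∀ k u → longest k u ℕ.< n
  longest<n dag k u with longest-attained k u
  ... | _ , p , p≡longest = subst (ℕ._< n) p≡longest (edgeCount<n dag p)

  longest-stable : IsDAG G → ∀ u → longest (suc n) u ℕ.≤ longest n u
  longest-stable dag u with longest-attained (suc n) u
  ... | _ , p , p≡longest =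
    subst (ℕ._≤ longest n u) p≡longest (longest-maximal n p (ℕ.<⇒≤ (edgeCount<n dag p)))

  rank : Fin n → ℕ
  rank = longest n

  rank<n : IsDAG G → ∀ u → rank u ℕ.< n
  rank<n dag = longest<n dag n

  rank-decreasing : IsDAG G → ∀ e → rank (tgt G e) ℕ.< rank (src G e)
  rank-decreasing dag e = ℕ.≤-trans (longest-edge n e) (longest-stable dag (src G e))

-- ℕ→ℚ goes through the normalising _/_, whose gcd does not compute for a variable k.
ℕ→ℚ-mkℚ : ∀ k → ℕ→ℚ k ≡ mkℚ (ℤ.+ k) 0 (Coprime.sym (Coprime.1-coprimeTo k))
ℕ→ℚ-mkℚ k = normalize-coprime (Coprime.sym (Coprime.1-coprimeTo k))

ℕ→ℚ-mono : ∀ {a b} → a ℕ.≤ b → ℕ→ℚ a ≤ ℕ→ℚ b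
ℕ→ℚ-mono {a} {b} a≤b rewrite ℕ→ℚ-mkℚ a | ℕ→ℚ-mkℚ b =
  *≤* (subst₂ ℤ._≤_ (sym (ℤ.*-identityʳ (ℤ.+ a))) (sym (ℤ.*-identityʳ (ℤ.+ b))) (ℤ.+≤+ a≤b))

ℕ→ℚ-nonNeg : ∀ k → 0ℚ ≤ ℕ→ℚ k
ℕ→ℚ-nonNeg k = ℕ→ℚ-mono (z≤n {k})

ℕ→ℚ-homo-+ : ∀ a b → ℕ→ℚ (a ℕ.+ b) ≡ ℕ→ℚ a + ℕ→ℚ b
ℕ→ℚ-homo-+ a b rewrite ℕ→ℚ-mkℚ a | ℕ→ℚ-mkℚ b =
  cong (_/ 1) (trans (ℤ.pos-+ a b)
    (sym (cong₂ ℤ._+_ (ℤ.*-identityʳ (ℤ.+ a)) (ℤ.*-identityʳ (ℤ.+ b)))))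

+-cancelʳ-≤ : ∀ r {p q} → p + r ≤ q + r → p ≤ q
+-cancelʳ-≤ r {p} {q} p+r≤q+r = subst₂ _≤_ (x+r-r≡x p) (x+r-r≡x q) (+-monoˡ-≤ (- r) p+r≤q+r)
  where
  x+r-r≡x : ∀ x → x + r - r ≡ x
  x+r-r≡x x = trans (+-assoc x r (- r)) (trans (cong (x +_) (+-inverseʳ r)) (+-identityʳ x))

IsPotentialShift : {n : ℕ} (G : Graph n) → Weights G → Weights G → (Fin n → ℚ) → Set
IsPotentialShift G w wH P = ∀ e → wH e + P (tgt G e) ≡ w e + P (src G e)

module _ {n : ℕ} {G : Graph n} {w wH : Weights G} (P : Fin n → ℚ)
         (shift : IsPotentialShift G w wH P) where

  open import Algebra.Properties.CommutativeSemigroup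
    (CommutativeMonoid.commutativeSemigroup +-0-commutativeMonoid) using (x∙yz≈xz∙y; xy∙z≈xz∙y)

  len-potentialShift : ∀ {u v} (p : Path G u v) → len wH p + P v ≡ len w p + P u
  len-potentialShift []                      = refl
  len-potentialShift {v = v} (e ∷⟨ refl ⟩ p) = begin
    wH e + len wH p + P v          ≡⟨ +-assoc (wH e) (len wH p) (P v) ⟩
    wH e + (len wH p + P v)        ≡⟨ cong (wH e +_) (len-potentialShift p) ⟩
    wH e + (len w p + P (tgt G e)) ≡⟨ x∙yz≈xz∙y (wH e) (len w p) (P (tgt G e)) ⟩
    wH e + P (tgt G e) + len w p   ≡⟨ cong (_+ len w p) (shift e) ⟩
    w e + P (src G e) + len w p    ≡⟨ xy∙z≈xz∙y (w e) (P (src G e)) (len w p) ⟩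
    w e + len w p + P (src G e)    ∎
    where open ≡-Reasoning

  potentialShift⇒shortestPathsPreserving : ShortestPathsPreserving G w wH
  potentialShift⇒shortestPathsPreserving {u} {v} π π-shortest ρ =
    +-cancelʳ-≤ (P u) (subst₂ _≤_ (len-potentialShift π) (len-potentialShift ρ)
                                  (+-monoˡ-≤ (P v) (π-shortest ρ)))

module RankReweighting {n : ℕ} (G : Graph n) (w : Weights G) (w>0 : PositiveWeights G w)
  (r : Fin n → ℕ) (r<n : ∀ v → r v ℕ.< n) (r-decreasing : ∀ e → r (tgt G e) ℕ.< r (src G e)) where

  open Data.List.Extrema (DecTotalOrder.totalOrder ≤-decTotalOrder) using (max; ⊥≤max; xs≤max)

  W : ℚ
  W = max 0ℚ (map w (allFin (m G)))

  0≤W : 0ℚ ≤ W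
  0≤W = ⊥≤max 0ℚ (map w (allFin (m G)))

  w≤W : ∀ e → w e ≤ W
  w≤W e = All.lookup (xs≤max 0ℚ (map w (allFin (m G)))) (∈-map⁺ w (∈-allFin e))

  scaled : ℕ → ℚ
  scaled k = W * ℕ→ℚ k

  scaled-mono : ∀ {a b} → a ℕ.≤ b → scaled a ≤ scaled b
  scaled-mono a≤b = *-monoˡ-≤-nonNeg W {{nonNegative 0≤W}} (ℕ→ℚ-mono a≤b)

  scaled-homo-+ : ∀ a b → scaled (a ℕ.+ b) ≡ scaled a + scaled b
  scaled-homo-+ a b = trans (cong (W *_) (ℕ→ℚ-homo-+ a b)) (*-distribˡ-+ W (ℕ→ℚ a) (ℕ→ℚ b))

  scaled-nonNeg : ∀ k → 0ℚ ≤ scaled k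
  scaled-nonNeg k = subst (_≤ scaled k) (*-zeroʳ W) (scaled-mono (z≤n {k}))

  scaled-1 : scaled 1 ≡ W
  scaled-1 = *-identityʳ W

  rankDrop : Fin (m G) → ℕ
  rankDrop e = r (src G e) ℕ.∸ r (tgt G e)

  rankDrop-positive : ∀ e → 1 ℕ.≤ rankDrop e
  rankDrop-positive e = ℕ.m<n⇒0<n∸m (r-decreasing e)

  rankDrop<n : ∀ e → rankDrop e ℕ.< n
  rankDrop<n e = ℕ.≤-<-trans (ℕ.m∸n≤m (r (src G e)) (r (tgt G e))) (r<n (src G e))

  rankDrop+rank-tgt : ∀ e → rankDrop e ℕ.+ r (tgt G e) ≡ r (src G e)
  rankDrop+rank-tgt e = ℕ.m∸n+n≡m (ℕ.<⇒≤ (r-decreasing e))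

  wH : Weights G
  wH e = w e + scaled (rankDrop e)

  potential : Fin n → ℚ
  potential v = scaled (r v)

  wH-potentialShift : IsPotentialShift G w wH potential
  wH-potentialShift e = begin
    w e + scaled (rankDrop e) + potential (tgt G e)   ≡⟨ +-assoc (w e) _ _ ⟩
    w e + (scaled (rankDrop e) + potential (tgt G e)) ≡⟨ cong (w e +_) (scaled-homo-+ (rankDrop e) _) ⟨
    w e + scaled (rankDrop e ℕ.+ r (tgt G e))         ≡⟨ cong (λ k → w e + scaled k) (rankDrop+rank-tgt e) ⟩
    w e + potential (src G e)                         ∎
    where open ≡-Reasoning

  wH-positive : PositiveWeights G wH
  wH-positive e = +-mono-<-≤ (w>0 e) (scaled-nonNeg (rankDrop e))

  W≤wH : ∀ e → W ≤ wH e
  W≤wH e = begin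
    W                         ≡⟨ scaled-1 ⟨
    scaled 1                  ≤⟨ scaled-mono (rankDrop-positive e) ⟩
    scaled (rankDrop e)       ≡⟨ +-identityˡ (scaled (rankDrop e)) ⟨
    0ℚ + scaled (rankDrop e)  ≤⟨ +-monoˡ-≤ (scaled (rankDrop e)) (<⇒≤ (w>0 e)) ⟩
    wH e                      ∎
    where open ≤-Reasoning

  wH≤nW : ∀ e → wH e ≤ ℕ→ℚ n * W
  wH≤nW e = begin
    w e + scaled (rankDrop e)       ≤⟨ +-monoˡ-≤ (scaled (rankDrop e)) (w≤W e) ⟩
    W + scaled (rankDrop e)         ≡⟨ cong (_+ scaled (rankDrop e)) scaled-1 ⟨
    scaled 1 + scaled (rankDrop e)  ≡⟨ scaled-homo-+ 1 (rankDrop e) ⟨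
    scaled (suc (rankDrop e))       ≤⟨ scaled-mono (rankDrop<n e) ⟩
    scaled n                        ≡⟨ *-comm W (ℕ→ℚ n) ⟩
    ℕ→ℚ n * W                       ∎
    where open ≤-Reasoning

  wH-aspectRatio : AspectRatio≤ G wH (ℕ→ℚ n)
  wH-aspectRatio e e' =
    ≤-trans (wH≤nW e) (*-monoˡ-≤-nonNeg (ℕ→ℚ n) {{nonNegative (ℕ→ℚ-nonNeg n)}} (W≤wH e'))

theorem1p3 : Σ ℕ λ c → (n : ℕ) (G : Graph n) (w : Weights G) →
    IsDAG G → PositiveWeights G w →
    Σ (Weights G) λ wH → PositiveWeights G wH × ShortestPathsPreserving G w wH
    × AspectRatio≤ G wH (ℕ→ℚ (c ℕ.* n))
theorem1p3 = 1 , λ n G w dag w>0 →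
  let open RankReweighting G w w>0 (rank G) (rank<n G dag) (rank-decreasing G dag) in
  wH , wH-positive , potentialShift⇒shortestPathsPreserving potential wH-potentialShift ,
  subst (AspectRatio≤ G wH ∘ ℕ→ℚ) (sym (ℕ.*-identityˡ n)) wH-aspectRatio
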